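{- Let $G=(V,E)$ be a finite simple undirected graph with $m=|E|$, $s\in V$, $W\subseteq V$, and suppose all vertices of $W\cup\{s\}$ lie in one connected component of $G$. Let $S\subseteq\{0,1\}^E$ be the set of orientations $f$ of $G$ such that every $w\in W$ is reachable from $s$ in $\vec G^f$, and let $\tau$ be the number of edges of a minimum Steiner tree for $W\cup\{s\}$ in $G$ (the minimum number of edges of a tree subgraph of $G$ containing all vertices of $W\cup\{s\}$). Then $\mathrm{dvc}(S)=\mathrm{vc}(S)=m-\tau$.
   Context: Fix an arbitrary reference direction for each edge of $G$. An orientation of $G$ is a function $f\in\{0,1\}^E$; $\vec G^f$ is the digraph obtained by directing each edge $e$ along its reference direction if $f(e)=0$ and against it if $f(e)=1$. For disjoint sets $A,B$ and $g\in\{0,1\}^A$, $h\in\{0,1\}^B$, $g\star h\in\{0,1\}^{A\cup B}$ is the function agreeing with $g$ on $A$ and with $h$ on $B$. For $S\subseteq\{0,1\}^E$ and $Y\subseteq E$: $S$ shatters $Y$ if for every $h\in\{0,1\}^Y$ there exists $g\in\{0,1\}^{E\setminus Y}$ with $g\star h\in S$; $S$ strongly shatters $Y$ if there exists $g\in\{0,1\}^{E\setminus Y}$ such that $g\star h\in S$ for every $h\in\{0,1\}^Y$. $\mathrm{vc}(S)$ (resp. $\mathrm{dvc}(S)$) is the maximum of $|Y|$ over sets $Y$ shattered (resp. strongly shattered) by $S$. -}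

module Defs where

open import Data.Nat using (ℕ; _≤_; _∸_)
open import Data.Bool using (Bool; true; false; if_then_else_)
open import Data.Fin using (Fin)
open import Data.Fin.Subset using (Subset; _∈_; _∉_; ∣_∣)
open import Data.Vec using (lookup)
open import Data.List using (List; []; _∷_)
open import Data.List.Relation.Unary.Unique.Propositional using (Unique)
open import Data.Product using (Σ; _×_; _,_; ∃; ∃-syntax; proj₁; proj₂)
open import Data.Sum using (_⊎_)
open import Relation.Binary.PropositionalEquality using (_≡_; _≢_)
open import Relation.Binary.Construct.Closure.ReflexiveTransitive using (Star)
open import Relation.Nullary using (¬_)

-- Edge e has endpoints (proj₁ (edge e) , proj₂ (edge e)); the pair order
-- is the fixed reference direction proj₁ → proj₂.

record Graph (n m : ℕ) : Set where
  field
    edge   : Fin m → Fin n × Fin n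
    noLoop : ∀ e → proj₁ (edge e) ≢ proj₂ (edge e)
    noMulti : ∀ e e′ →
      (  (proj₁ (edge e) ≡ proj₁ (edge e′) × proj₂ (edge e) ≡ proj₂ (edge e′))
       ⊎ (proj₁ (edge e) ≡ proj₂ (edge e′) × proj₂ (edge e) ≡ proj₁ (edge e′)))
      → e ≡ e′

open Graph public

module _ {n m : ℕ} (G : Graph n m) where

  tl hd : Fin m → Fin n
  tl e = proj₁ (edge G e)
  hd e = proj₂ (edge G e)

  data Walk (T : Subset m) : Fin n → Fin n → List (Fin m) → Set where
    stop : ∀ {u} → Walk T u u []
    fwd  : ∀ {v es} e → e ∈ T → Walk T (hd e) v es → Walk T (tl e) v (e ∷ es)
    bwd  : ∀ {v es} e → e ∈ T → Walk T (tl e) v es → Walk T (hd e) v (e ∷ es)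

  allEdges : Subset m
  allEdges = Data.Vec.replicate m true
    where import Data.Vec

  Connected-in-G : Fin n → Fin n → Set
  Connected-in-G u v = ∃[ es ] Walk allEdges u v es

  -- Orientations: f e = false keeps the reference direction, true reverses.
  Orientation : Set
  Orientation = Fin m → Bool

  Arc : Orientation → Fin n → Fin n → Set
  Arc f u v = ∃[ e ] ((f e ≡ false × tl e ≡ u × hd e ≡ v)
                    ⊎ (f e ≡ true  × hd e ≡ u × tl e ≡ v))

  Reachable : Orientation → Fin n → Fin n → Set
  Reachable f = Star (Arc f)

  ReachOrient : Fin n → Subset n → Orientation → Set
  ReachOrient s W f = ∀ w → w ∈ W → Reachable f s w

  IsTree : Subset n → Subset m → Set
  IsTree U T =
      (∀ e → e ∈ T → tl e ∈ U × hd e ∈ U)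
    × (∃[ u ] u ∈ U)
    × (∀ u v → u ∈ U → v ∈ U → ∃[ es ] Walk T u v es)
    × (∀ u e es → ¬ (Walk T u u (e ∷ es) × Unique (e ∷ es)))

  SteinerTree : Fin n → Subset n → Subset n → Subset m → Set
  SteinerTree s W U T = IsTree U T × s ∈ U × (∀ w → w ∈ W → w ∈ U)

  IsMinSteinerSize : Fin n → Subset n → ℕ → Set
  IsMinSteinerSize s W τ =
      (∃[ U ] ∃[ T ] (SteinerTree s W U T × ∣ T ∣ ≡ τ))
    × (∀ U T → SteinerTree s W U T → τ ≤ ∣ T ∣)

_⋆[_]_ : ∀ {m} → (Fin m → Bool) → Subset m → (Fin m → Bool) → Fin m → Bool
(g ⋆[ Y ] h) e = if lookup Y e then h e else g e

Shatters : ∀ {m} → ((Fin m → Bool) → Set) → Subset m → Set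
Shatters S Y = ∀ (h : Fin _ → Bool) → ∃[ g ] S (g ⋆[ Y ] h)

StronglyShatters : ∀ {m} → ((Fin m → Bool) → Set) → Subset m → Set
StronglyShatters S Y = ∃[ g ] ∀ (h : Fin _ → Bool) → S (g ⋆[ Y ] h)

IsMaxSize : ∀ {m} → (Subset m → Set) → ℕ → Set
IsMaxSize P k = (∃[ Y ] (P Y × ∣ Y ∣ ≡ k)) × (∀ Y → P Y → ∣ Y ∣ ≤ k)

IsVC IsDVC : ∀ {m} → ((Fin m → Bool) → Set) → ℕ → Set
IsVC  S = IsMaxSize (Shatters S)
IsDVC S = IsMaxSize (StronglyShatters S)

module Submission where

-- Everything is phrased through edge sets T ⊆ E.  The component C T of s in
-- the spanning subgraph (V , T) is computed by breadth-first search, with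
-- levels R T 0 ⊆ R T 1 ⊆ …; say that T *connects* W if W ⊆ C T.
--   * A minimum-size connecting T exists (finite search) and (C T , T) is a
--     Steiner tree: an edge whose endpoints miss C T, or one lying on a cycle,
--     could be deleted.  Conversely every Steiner tree connects W, so
--     τ = min { |T| : T connects W }.
--   * Lower bound: orienting every edge of a connecting T away from s (from
--     an earlier BFS level to a later one) makes W reachable whatever the
--     other edges do, so E ∖ T is strongly shattered.
--   * Upper bound: if Y is shattered, take the orientation pointing every
--     Y-edge into the component D of s in (V , E ∖ Y); then nothing outside D
--     is reachable, so E ∖ Y connects W and τ ≤ m − |Y|.
-- Strong shattering implies shattering, so both maxima equal m − τ.

open import Defs
open import Data.Nat using (ℕ; zero; suc; _∸_; _≤_; _<_; _≤′_; ≤′-reflexive; ≤′-step; z≤n; s≤s; _≤?_)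
open import Data.Nat.Properties
  using (≤-refl; ≤-trans; ≤-total; ≤-<-trans; <⇒≤; <-irrefl; ≤⇒≤′; ≰⇒>; ≤-reflexive; 1+n≰n; m∸[m∸n]≡n; ∸-monoʳ-≤)
open import Data.Fin using (Fin; _≟_; toℕ; fromℕ<)
open import Data.Fin.Properties using (any?; all?; toℕ-fromℕ<)
open import Data.Fin.Subset using (Subset; _∈_; _∉_; ∣_∣; ⁅_⁆; _⊆_; _-_; ∁)
open import Data.Fin.Subset.Properties
  using (_∈?_; anySubset?; x∈⁅y⁆⇒x≡y; x∈⁅x⁆; ∣⁅x⁆∣≡1; ⊆-antisym; p⊂q⇒∣p∣<∣q∣; ∣p∣≤n;
         x∈p∧x≢y⇒x∈p-y; x∈p⇒∣p-x∣<∣p∣; x∉p⇒x∈∁p; x∈p⇒x∉∁p; ∣∁p∣≡n∸∣p∣)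
open import Data.Product using (_×_; _,_; ∃-syntax; proj₁; proj₂)
open import Data.Sum using (_⊎_; inj₁; inj₂)
open import Data.Bool using (Bool; true; false; not)
open import Data.List using ([]; _∷_; _++_)
open import Data.List.Relation.Unary.All using (All; []; _∷_)
open import Data.List.Relation.Unary.AllPairs using (_∷_)
open import Data.List.Relation.Unary.Unique.Propositional using (Unique)
open import Data.Vec using (tabulate; lookup)
open import Data.Vec.Properties using (lookup∘tabulate; []=⇒lookup; lookup⇒[]=)
open import Data.Empty using (⊥-elim)
open import Relation.Binary.PropositionalEquality using (_≡_; _≢_; refl; sym; trans; cong; subst)
open import Relation.Binary.Construct.Closure.ReflexiveTransitive using (ε; _◅_; _◅◅_)
open import Relation.Nullary using (¬_; Dec; yes; no; does)
open import Relation.Nullary.Decidable using (_×-dec_; _⊎-dec_; ¬?; _→-dec_; dec-true; dec-false)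

subsetOf : ∀ {k} {P : Fin k → Set} → (∀ x → Dec (P x)) → Subset k
subsetOf P? = tabulate (λ x → does (P? x))

∈-subsetOf⁻ : ∀ {k} {P : Fin k → Set} (P? : ∀ x → Dec (P x)) {x} → x ∈ subsetOf P? → P x
∈-subsetOf⁻ P? {x} x∈ with P? x | trans (sym (lookup∘tabulate (λ y → does (P? y)) x)) ([]=⇒lookup x∈)
... | yes p | _  = p
... | no _  | ()

∈-subsetOf⁺ : ∀ {k} {P : Fin k → Set} (P? : ∀ x → Dec (P x)) {x} → P x → x ∈ subsetOf P?
∈-subsetOf⁺ P? {x} p =
  lookup⇒[]= x (subsetOf P?) (trans (lookup∘tabulate (λ y → does (P? y)) x) (dec-true (P? x) p))

not-does-false : ∀ {A : Set} (d : Dec A) → not (does d) ≡ false → A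
not-does-false (yes a) _ = a
not-does-false (no _) ()

not-does-true : ∀ {A : Set} (d : Dec A) → not (does d) ≡ true → ¬ A
not-does-true (yes _) ()
not-does-true (no ¬a) _ = ¬a

minimum-size : ∀ {k} {P : Subset k → Set} → (∀ X → Dec (P X)) → ∀ X → P X →
               ∃[ X₀ ] (P X₀ × (∀ X′ → P X′ → ∣ X₀ ∣ ≤ ∣ X′ ∣))
minimum-size {P = P} P? X pX = search ∣ X ∣ X pX ≤-refl
  where
  search : ∀ b X → P X → ∣ X ∣ ≤ b → ∃[ X₀ ] (P X₀ × (∀ X′ → P X′ → ∣ X₀ ∣ ≤ ∣ X′ ∣))
  search zero X pX ≤0 = X , pX , λ X′ _ → ≤-trans ≤0 z≤n
  search (suc b) X pX ≤b+1 with anySubset? (λ X′ → P? X′ ×-dec (∣ X′ ∣ ≤? b))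
  ... | yes (X′ , pX′ , ≤b) = search b X′ pX′ ≤b
  ... | no none = X , pX , least
    where
    least : ∀ X′ → P X′ → ∣ X ∣ ≤ ∣ X′ ∣
    least X′ pX′ with ∣ X′ ∣ ≤? b
    ... | yes ≤b = ⊥-elim (none (X′ , pX′ , ≤b))
    ... | no ≰b = ≤-trans ≤b+1 (≰⇒> ≰b)

⋆-inside : ∀ {k} (g h : Fin k → Bool) {Y e} → e ∈ Y → (g ⋆[ Y ] h) e ≡ h e
⋆-inside g h {Y} {e} e∈Y rewrite []=⇒lookup e∈Y = refl

⋆-outside : ∀ {k} (g h : Fin k → Bool) {Y e} → e ∉ Y → (g ⋆[ Y ] h) e ≡ g e
⋆-outside g h {Y} {e} e∉Y with lookup Y e in eq
... | true  = ⊥-elim (e∉Y (lookup⇒[]= e Y eq))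
... | false = refl

strong⇒shatters : ∀ {k} (S : (Fin k → Bool) → Set) Y → StronglyShatters S Y → Shatters S Y
strong⇒shatters S Y (g , all-h) h = g , all-h h

≤-∸-swap : ∀ {m y t} → y ≤ m → t ≤ m ∸ y → y ≤ m ∸ t
≤-∸-swap {m} {y} {t} y≤m t≤ = subst (_≤ m ∸ t) (m∸[m∸n]≡n y≤m) (∸-monoʳ-≤ m t≤)

module Walks {n m : ℕ} (G : Graph n m) where

  Conn : Subset m → Fin n → Fin n → Set
  Conn T a b = ∃[ es ] Walk G T a b es

  _++ʷ_ : ∀ {T a b c xs ys} → Walk G T a b xs → Walk G T b c ys → Walk G T a c (xs ++ ys)
  stop        ++ʷ q = q
  fwd e e∈ p  ++ʷ q = fwd e e∈ (p ++ʷ q)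
  bwd e e∈ p  ++ʷ q = bwd e e∈ (p ++ʷ q)

  Conn-trans : ∀ {T a b c} → Conn T a b → Conn T b c → Conn T a c
  Conn-trans (xs , p) (ys , q) = xs ++ ys , p ++ʷ q

  reverse : ∀ {T a b xs} → Walk G T a b xs → Conn T b a
  reverse stop         = [] , stop
  reverse (fwd e e∈ p) = Conn-trans (reverse p) (e ∷ [] , bwd e e∈ stop)
  reverse (bwd e e∈ p) = Conn-trans (reverse p) (e ∷ [] , fwd e e∈ stop)

  Conn-sym : ∀ {T a b} → Conn T a b → Conn T b a
  Conn-sym (_ , p) = reverse p

  restrict : ∀ {T e a b es} → All (e ≢_) es → Walk G T a b es → Walk G (T - e) a b es
  restrict [] stop = stop
  restrict (e≢ ∷ ≢s) (fwd e′ e′∈ p) = fwd e′ (x∈p∧x≢y⇒x∈p-y e′∈ (λ eq → e≢ (sym eq))) (restrict ≢s p)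
  restrict (e≢ ∷ ≢s) (bwd e′ e′∈ p) = bwd e′ (x∈p∧x≢y⇒x∈p-y e′∈ (λ eq → e≢ (sym eq))) (restrict ≢s p)

  reroute : ∀ {T e a b es} → Conn (T - e) (tl G e) (hd G e) → Walk G T a b es → Conn (T - e) a b
  reroute link stop = [] , stop
  reroute {e = e} link (fwd e′ e′∈ p) with e′ ≟ e
  ... | yes refl = Conn-trans link (reroute link p)
  ... | no e′≢e  = Conn-trans (_ , fwd e′ (x∈p∧x≢y⇒x∈p-y e′∈ e′≢e) stop) (reroute link p)
  reroute {e = e} link (bwd e′ e′∈ p) with e′ ≟ e
  ... | yes refl = Conn-trans (Conn-sym link) (reroute link p)
  ... | no e′≢e  = Conn-trans (_ , bwd e′ (x∈p∧x≢y⇒x∈p-y e′∈ e′≢e) stop) (reroute link p)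

module Component {n m : ℕ} (G : Graph n m) (s : Fin n) where
  open Walks G

  Adj : Subset m → Subset n → Fin n → Set
  Adj T A v = ∃[ e ] (e ∈ T × ((tl G e ∈ A × hd G e ≡ v) ⊎ (hd G e ∈ A × tl G e ≡ v)))

  adj? : ∀ T A v → Dec (Adj T A v)
  adj? T A v = any? λ e → (e ∈? T) ×-dec
    (((tl G e ∈? A) ×-dec (hd G e ≟ v)) ⊎-dec ((hd G e ∈? A) ×-dec (tl G e ≟ v)))

  step : Subset m → Subset n → Subset n
  step T A = subsetOf (λ v → (v ∈? A) ⊎-dec adj? T A v)

  step-infl : ∀ {T A} → A ⊆ step T A
  step-infl {T} {A} v∈ = ∈-subsetOf⁺ (λ v → (v ∈? A) ⊎-dec adj? T A v) (inj₁ v∈)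

  step⁻ : ∀ {T A v} → v ∈ step T A → v ∈ A ⊎ Adj T A v
  step⁻ {T} {A} = ∈-subsetOf⁻ (λ v → (v ∈? A) ⊎-dec adj? T A v)

  step⁺ : ∀ {T A v} → Adj T A v → v ∈ step T A
  step⁺ {T} {A} adj = ∈-subsetOf⁺ (λ v → (v ∈? A) ⊎-dec adj? T A v) (inj₂ adj)

  -- R T k: vertices within k T-edges of s; n rounds reach the whole component.
  R : Subset m → ℕ → Subset n
  R T zero    = ⁅ s ⁆
  R T (suc k) = step T (R T k)

  C : Subset m → Subset n
  C T = R T n

  s∈R : ∀ T k → s ∈ R T k
  s∈R T zero    = x∈⁅x⁆ s
  s∈R T (suc k) = step-infl (s∈R T k)

  R-mono : ∀ T {k k′} → k ≤′ k′ → R T k ⊆ R T k′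
  R-mono T (≤′-reflexive refl) v∈ = v∈
  R-mono T (≤′-step k≤′k′)              v∈ = step-infl (R-mono T k≤′k′ v∈)

  R-sound : ∀ T k {v} → v ∈ R T k → Conn T s v
  R-sound T zero v∈ with x∈⁅y⁆⇒x≡y s v∈
  ... | refl = [] , stop
  R-sound T (suc k) v∈ with step⁻ v∈
  ... | inj₁ v∈k = R-sound T k v∈k
  ... | inj₂ (e , e∈ , inj₁ (t∈ , refl)) = Conn-trans (R-sound T k t∈) (_ , fwd e e∈ stop)
  ... | inj₂ (e , e∈ , inj₂ (h∈ , refl)) = Conn-trans (R-sound T k h∈) (_ , bwd e e∈ stop)

  stable-propagates : ∀ T k → step T (R T k) ⊆ R T k → step T (R T (suc k)) ⊆ R T (suc k)
  stable-propagates T k stable = subst (λ X → step T X ⊆ X) (sym (⊆-antisym stable step-infl)) stable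

  growth : ∀ T k → (step T (R T k) ⊆ R T k) ⊎ (suc k ≤ ∣ R T k ∣)
  growth T zero = inj₂ (≤-reflexive (sym (∣⁅x⁆∣≡1 s)))
  growth T (suc k) with growth T k
  ... | inj₁ stable = inj₁ (stable-propagates T k stable)
  ... | inj₂ big with any? (λ v → (v ∈? R T (suc k)) ×-dec ¬? (v ∈? R T k))
  ...   | yes (v , v∈ , v∉) = inj₂ (≤-trans (s≤s big) (p⊂q⇒∣p∣<∣q∣ (step-infl , v , v∈ , v∉)))
  ...   | no nothing-new = inj₁ (stable-propagates T k stable)
    where
    stable : step T (R T k) ⊆ R T k
    stable {v} v∈ with v ∈? R T k
    ... | yes v∈k = v∈k
    ... | no v∉k  = ⊥-elim (nothing-new (v , v∈ , v∉k))

  C-closed : ∀ T → step T (C T) ⊆ C T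
  C-closed T with growth T n
  ... | inj₁ stable = stable
  ... | inj₂ big    = ⊥-elim (1+n≰n (≤-trans big (∣p∣≤n (C T))))

  C-fwd : ∀ T {e} → e ∈ T → tl G e ∈ C T → hd G e ∈ C T
  C-fwd T e∈ t∈ = C-closed T (step⁺ (_ , e∈ , inj₁ (t∈ , refl)))

  C-bwd : ∀ T {e} → e ∈ T → hd G e ∈ C T → tl G e ∈ C T
  C-bwd T e∈ h∈ = C-closed T (step⁺ (_ , e∈ , inj₂ (h∈ , refl)))

  walk-closed : ∀ {T a b es} → Walk G T a b es → a ∈ C T → b ∈ C T
  walk-closed stop               a∈ = a∈
  walk-closed {T} (fwd e e∈ p)   a∈ = walk-closed p (C-fwd T e∈ a∈)
  walk-closed {T} (bwd e e∈ p)   a∈ = walk-closed p (C-bwd T e∈ a∈)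

  conn⇒C : ∀ {T v} → Conn T s v → v ∈ C T
  conn⇒C {T} (_ , p) = walk-closed p (s∈R T n)

  detached-edge : ∀ {T e v} → tl G e ∉ C T → v ∈ C T → v ∈ C (T - e)
  detached-edge {T} {e} {v} t∉ v∈ = conn⇒C (_ , restrict (avoids walk (s∈R T n)) walk)
    where
    walk : Walk G T s v (proj₁ (R-sound T n v∈))
    walk = proj₂ (R-sound T n v∈)

    avoids : ∀ {a b es} → Walk G T a b es → a ∈ C T → All (e ≢_) es
    avoids stop _ = []
    avoids (fwd e′ e′∈ p) a∈ = (λ { refl → t∉ a∈ }) ∷ avoids p (C-fwd T e′∈ a∈)
    avoids (bwd e′ e′∈ p) a∈ = (λ { refl → t∉ (C-bwd T e′∈ a∈) }) ∷ avoids p (C-bwd T e′∈ a∈)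

  bypassed-edge : ∀ {T e v} → Conn (T - e) (tl G e) (hd G e) → v ∈ C T → v ∈ C (T - e)
  bypassed-edge {T} link v∈ = conn⇒C (reroute link (proj₂ (R-sound T n v∈)))

  Precedes : Subset m → Fin n → Fin n → Set
  Precedes T u v = ∃[ k ] (u ∈ R T (toℕ {n} k) × v ∉ R T (toℕ k))

  precedes? : ∀ T u v → Dec (Precedes T u v)
  precedes? T u v = any? λ k → (u ∈? R T (toℕ k)) ×-dec ¬? (v ∈? R T (toℕ k))

  precedes-asym : ∀ {T u v} → Precedes T u v → ¬ Precedes T v u
  precedes-asym {T} (k , u∈ , v∉) (k′ , v∈ , u∉) with ≤-total (toℕ k) (toℕ k′)
  ... | inj₁ k≤k′ = u∉ (R-mono T (≤⇒≤′ k≤k′) u∈)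
  ... | inj₂ k′≤k = v∉ (R-mono T (≤⇒≤′ k′≤k) v∈)

  -- Orient each edge from its BFS-earlier endpoint to the other one.
  outward : Subset m → Orientation G
  outward T e = not (does (precedes? T (tl G e) (hd G e)))

  precedes-at : ∀ {T u v k} → k < n → u ∈ R T k → v ∉ R T k → Precedes T u v
  precedes-at {T} {u} {v} k<n u∈ v∉ =
    fromℕ< k<n , subst (λ j → u ∈ R T j) (sym (toℕ-fromℕ< k<n)) u∈
               , subst (λ j → v ∉ R T j) (sym (toℕ-fromℕ< k<n)) v∉

  forward-arc : ∀ {T f e k} → f e ≡ outward T e → k < n →
                tl G e ∈ R T k → hd G e ∉ R T k → Arc G f (tl G e) (hd G e)
  forward-arc {T} {f} {e} fe k<n t∈ h∉ =
    e , inj₁ (trans fe (cong not (dec-true (precedes? T (tl G e) (hd G e)) (precedes-at k<n t∈ h∉))) , refl , refl)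

  backward-arc : ∀ {T f e k} → f e ≡ outward T e → k < n →
                 hd G e ∈ R T k → tl G e ∉ R T k → Arc G f (hd G e) (tl G e)
  backward-arc {T} {f} {e} fe k<n h∈ t∉ =
    e , inj₂ (trans fe (cong not (dec-false (precedes? T (tl G e) (hd G e)) tl-not-first)) , refl , refl)
    where
    tl-not-first : ¬ Precedes T (tl G e) (hd G e)
    tl-not-first = precedes-asym (precedes-at k<n h∈ t∉)

  outward-reaches : ∀ T (f : Orientation G) → (∀ {e} → e ∈ T → f e ≡ outward T e) →
                    ∀ {v} → v ∈ C T → Reachable G f s v
  outward-reaches T f agree = level n ≤-refl
    where
    level : ∀ k → k ≤ n → ∀ {v} → v ∈ R T k → Reachable G f s v
    level zero _ v∈ with x∈⁅y⁆⇒x≡y s v∈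
    ... | refl = ε
    level (suc k) k<n {v} v∈ with v ∈? R T k | step⁻ v∈
    ... | yes v∈k | _        = level k (<⇒≤ k<n) v∈k
    ... | no v∉k  | inj₁ v∈k = ⊥-elim (v∉k v∈k)
    ... | no v∉k  | inj₂ (e , e∈ , inj₁ (t∈ , refl)) =
      level k (<⇒≤ k<n) t∈ ◅◅ (forward-arc (agree e∈) k<n t∈ v∉k ◅ ε)
    ... | no v∉k  | inj₂ (e , e∈ , inj₂ (h∈ , refl)) =
      level k (<⇒≤ k<n) h∈ ◅◅ (backward-arc (agree e∈) k<n h∈ v∉k ◅ ε)

module Connecting {n m : ℕ} (G : Graph n m) (s : Fin n) (W : Subset n) where
  open Walks G
  open Component G s

  Connects : Subset m → Set
  Connects T = ∀ w → w ∈ W → w ∈ C T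

  connects? : ∀ T → Dec (Connects T)
  connects? T = all? λ w → (w ∈? W) →-dec (w ∈? C T)

  steiner⇒connects : ∀ {U T} → SteinerTree G s W U T → Connects T
  steiner⇒connects ((_ , _ , tree-conn , _) , s∈U , W⊆U) w w∈ = conn⇒C (tree-conn s w s∈U (W⊆U w w∈))

  module MinimumConnector (T : Subset m) (T-connects : Connects T)
                          (T-min : ∀ T′ → Connects T′ → ∣ T ∣ ≤ ∣ T′ ∣) where

    irremovable : ∀ {e} → e ∈ T → ¬ Connects (T - e)
    irremovable e∈ connects = <-irrefl refl (≤-<-trans (T-min _ connects) (x∈p⇒∣p-x∣<∣p∣ e∈))

    endpoints-in-C : ∀ e → e ∈ T → tl G e ∈ C T × hd G e ∈ C T
    endpoints-in-C e e∈ with tl G e ∈? C T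
    ... | yes t∈ = t∈ , C-fwd T e∈ t∈
    ... | no t∉  = ⊥-elim (irremovable e∈ (λ w w∈ → detached-edge t∉ (T-connects w w∈)))

    -- A cycle through e joins the endpoints of e in T − e.
    acyclic : ∀ u e es → ¬ (Walk G T u u (e ∷ es) × Unique (e ∷ es))
    acyclic u e es (fwd _ e∈ p , e∉es ∷ _) =
      irremovable e∈ (λ w w∈ → bypassed-edge (reverse (restrict e∉es p)) (T-connects w w∈))
    acyclic u e es (bwd _ e∈ p , e∉es ∷ _) =
      irremovable e∈ (λ w w∈ → bypassed-edge (_ , restrict e∉es p) (T-connects w w∈))

    steinerTree : SteinerTree G s W (C T) T
    steinerTree = ( endpoints-in-C , (s , s∈R T n)
                  , (λ u v u∈ v∈ → Conn-trans (Conn-sym (R-sound T n u∈)) (R-sound T n v∈))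
                  , acyclic )
                , s∈R T n , T-connects

  connects⇒stronglyShattered : ∀ {T} → Connects T → StronglyShatters (ReachOrient G s W) (∁ T)
  connects⇒stronglyShattered {T} T-connects = outward T , λ h w w∈ →
    outward-reaches T (outward T ⋆[ ∁ T ] h) (λ e∈ → ⋆-outside (outward T) h (x∈p⇒x∉∁p e∈)) (T-connects w w∈)

  module Shattered (Y : Subset m) where

    D : Subset n
    D = C (∁ Y)

    -- Point every edge towards D whenever its head lies in D.
    toward : Orientation G
    toward e = not (does (hd G e ∈? D))

    arc-stays : ∀ g {u v} → Arc G (g ⋆[ Y ] toward) u v → u ∈ D → v ∈ D
    arc-stays g (e , dir) u∈ with e ∈? Y
    arc-stays g (e , inj₁ (_ , refl , refl)) u∈ | no e∉Y = C-fwd (∁ Y) (x∉p⇒x∈∁p e∉Y) u∈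
    arc-stays g (e , inj₂ (_ , refl , refl)) u∈ | no e∉Y = C-bwd (∁ Y) (x∉p⇒x∈∁p e∉Y) u∈
    arc-stays g (e , inj₁ (fe , refl , refl)) u∈ | yes e∈Y =
      not-does-false (hd G e ∈? D) (trans (sym (⋆-inside g toward e∈Y)) fe)
    arc-stays g (e , inj₂ (fe , refl , refl)) u∈ | yes e∈Y =
      ⊥-elim (not-does-true (hd G e ∈? D) (trans (sym (⋆-inside g toward e∈Y)) fe) u∈)

    stays : ∀ g {a b} → Reachable G (g ⋆[ Y ] toward) a b → a ∈ D → b ∈ D
    stays g ε        a∈ = a∈
    stays g (x ◅ xs) a∈ = stays g xs (arc-stays g x a∈)

    shattered⇒connects : Shatters (ReachOrient G s W) Y → Connects (∁ Y)
    shattered⇒connects sh w w∈ = stays (proj₁ (sh toward)) (proj₂ (sh toward) w w∈) (s∈R (∁ Y) n)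

  open Shattered using (shattered⇒connects) public

proposition4p14 : ∀ {n m} (G : Graph n m) (s : Fin n) (W : Subset n) →
    (∀ w → w ∈ W → Connected-in-G G s w) →
    ∃[ τ ] (IsMinSteinerSize G s W τ
    × IsDVC (ReachOrient G s W) (m ∸ τ)
    × IsVC (ReachOrient G s W) (m ∸ τ))
proposition4p14 {n} {m} G s W connected =
  ∣ T ∣ , ((C T , T , steinerTree , refl) , (λ U T′ tree → T-min T′ (steiner⇒connects tree)))
        , ((∁ T , ∁T-strong , ∣∁p∣≡n∸∣p∣ T) , (λ Y strong → bound Y (strong⇒shatters S Y strong)))
        , ((∁ T , strong⇒shatters S (∁ T) ∁T-strong , ∣∁p∣≡n∸∣p∣ T) , bound)
  where
  open Component G s
  open Connecting G s W

  S : Orientation G → Set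
  S = ReachOrient G s W

  -- All edges connect W, so a minimum connecting set T exists; τ = |T|.
  minimum : ∃[ T ] (Connects T × (∀ T′ → Connects T′ → ∣ T ∣ ≤ ∣ T′ ∣))
  minimum = minimum-size connects? (allEdges G) (λ w w∈ → conn⇒C (connected w w∈))

  T : Subset m
  T = proj₁ minimum

  T-connects : Connects T
  T-connects = proj₁ (proj₂ minimum)

  T-min : ∀ T′ → Connects T′ → ∣ T ∣ ≤ ∣ T′ ∣
  T-min = proj₂ (proj₂ minimum)

  open MinimumConnector T T-connects T-min using (steinerTree)

  ∁T-strong : StronglyShatters S (∁ T)
  ∁T-strong = connects⇒stronglyShattered T-connects

  bound : ∀ Y → Shatters S Y → ∣ Y ∣ ≤ m ∸ ∣ T ∣
  bound Y sh = ≤-∸-swap (∣p∣≤n Y) (subst (∣ T ∣ ≤_) (∣∁p∣≡n∸∣p∣ Y) (T-min (∁ Y) (shattered⇒connects Y sh)))
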